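{- Let $n\ge 2$ and let $\sigma$ be a permutation of length $n-1$. Then the number of permutations of length $n$ that contain $\sigma$ as a pattern is exactly $n^2-2n+2=(n-1)^2+1$.
   Context: A permutation $\sigma$ is contained as a pattern in $\pi$ if some subsequence of $\pi$ has the same relative order as $\sigma$. -}

module Defs where

open import Data.Nat using (ℕ)
open import Data.Fin using (Fin; _<_)
open import Data.Vec using (Vec; lookup)
open import Data.List using (List; length)
open import Data.List.Membership.Propositional using (_∈_)
open import Data.List.Relation.Unary.Unique.Propositional using (Unique)
open import Data.Product using (Σ; _×_)
open import Function.Bundles using (_⇔_)
open import Function.Definitions using (Injective)
open import Relation.Binary.PropositionalEquality using (_≡_)

-- A permutation of length n in one-line notation: a vector (π(0),…,π(n-1))
-- of elements of {0,…,n-1} with pairwise distinct entries (i.e. the map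
-- i ↦ π(i) is injective, hence a bijection of Fin n).
IsPerm : {n : ℕ} → Vec (Fin n) n → Set
IsPerm {n} v = Injective _≡_ _≡_ (lookup v)

Contains : {k n : ℕ} → Vec (Fin k) k → Vec (Fin n) n → Set
Contains {k} {n} σ π =
  Σ (Fin k → Fin n) λ f →
    (∀ i j → i < j → f i < f j) ×
    (∀ i j → (lookup σ i < lookup σ j) ⇔ (lookup π (f i) < lookup π (f j)))

HasCount : {A : Set} → (A → Set) → ℕ → Set
HasCount {A} P c =
  Σ (List A) λ L → Unique L × (∀ x → (x ∈ L) ⇔ P x) × (length L ≡ c)

-- A permutation π of length n containing σ (of length n - 1) is σ with one
-- new entry inserted: a value v at a position p, the other entries keeping
-- the relative order of σ.  This gives n² pairs (p, v), and two pairs give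
-- the same π exactly through the collision
--   (q + 1, σ(q)) ~ (q, σ(q) + 1)   and   (q + 1, σ(q) + 1) ~ (q, σ(q)),
-- i.e. when the new entry and the old entry σ(q) form two adjacent
-- positions holding two adjacent values.  Every class therefore has exactly
-- one representative which is either at position 0 (n of them) or at a
-- position q + 1 with a value different from σ(q) and σ(q) + 1
-- ((n - 1)(n - 2) of them), for a total of n + (n - 1)(n - 2) = n² - 2n + 2.

module Submission where

open import Defs
open import Data.Nat using (ℕ; _≤_; _∸_; _+_; _*_)
open import Data.Fin using (Fin)
open import Data.Vec using (Vec)
open import Data.Product using (_×_)

open import Data.Nat using (zero; suc; z≤n; s≤s; _<_)
import Data.Nat.Properties as ℕ
open import Data.Nat.Tactic.RingSolver using (solve-∀)
open import Data.Fin as Fin using (zero; suc; punchIn; punchOut; inject₁; toℕ; _≟_)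
open import Data.Fin.Properties
  using ( any?; all?; injective⇒≤; <-cmp; <-asym; <⇒≢; ≤∧≢⇒<; ≤̄⇒inject₁<; toℕ-inject₁; toℕ-injective
        ; punchIn-injective; punchInᵢ≢i; punchIn-mono-≤; punchIn-cancel-≤
        ; punchOut-injective; punchOut-mono-≤; punchIn-punchOut; punchOut-punchIn; punchOut-cong )
open import Data.Fin.Induction using (<-weakInduction)
open import Data.Vec using (lookup; tabulate)
open import Data.Vec.Properties using (lookup∘tabulate; tabulate∘lookup; tabulate-cong)
open import Data.List using (List; []; _∷_; map; _++_; allFin; length; cartesianProductWith)
open import Data.List.Properties using (length-map; length-++; length-tabulate)
open import Data.List.Membership.Propositional using (_∈_)
open import Data.List.Membership.Propositional.Properties
  using (∈-map⁺; ∈-map⁻; ∈-++⁺ˡ; ∈-++⁺ʳ; ∈-++⁻; ∈-allFin; ∈-cartesianProductWith⁺; ∈-cartesianProductWith⁻)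
open import Data.List.Relation.Unary.Unique.Propositional using (Unique)
import Data.List.Relation.Unary.Unique.Propositional.Properties as Unique
open import Data.Product using (∃; ∃₂; _,_; proj₁; proj₂)
open import Data.Sum using (_⊎_; inj₁; inj₂)
open import Data.Empty using (⊥)
open import Function using (_∘_; id)
open import Function.Bundles using (_⇔_; mk⇔; Equivalence)
open import Function.Definitions using (Injective)
open import Relation.Binary.Core using (_Preserves_⟶_)
open import Relation.Binary.Definitions using (tri<; tri≈; tri>)
open import Relation.Nullary using (yes; no; ¬?; contradiction)
open import Relation.Binary.PropositionalEquality
  using (_≡_; _≢_; _≗_; refl; sym; trans; cong; cong₂; subst; subst₂; module ≡-Reasoning)

private variable
  m n : ℕ

StrictlyMonotone : (Fin m → Fin n) → Set
StrictlyMonotone f = f Preserves Fin._<_ ⟶ Fin._<_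

injective⇒surjective : {f : Fin n → Fin n} → Injective _≡_ _≡_ f → ∀ y → ∃ λ x → f x ≡ y
injective⇒surjective {f = f} f-injective y with any? (λ x → f x ≟ y)
... | yes hit = hit
injective⇒surjective {suc n} {f} f-injective y | no miss =
  contradiction (injective⇒≤ squeeze-injective) ℕ.1+n≰n
  where
    y≢f : ∀ x → y ≢ f x
    y≢f x y≡fx = miss (x , sym y≡fx)
    squeeze : Fin (suc n) → Fin n
    squeeze x = punchOut (y≢f x)
    squeeze-injective : Injective _≡_ _≡_ squeeze
    squeeze-injective {x} {x′} eq = f-injective (punchOut-injective (y≢f x) (y≢f x′) eq)

missing-value : (f : Fin n → Fin (suc n)) → ∃ λ y → ∀ x → f x ≢ y
missing-value f with any? (λ y → all? (λ x → ¬? (f x ≟ y)))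
... | yes missed = missed
... | no ¬missed = contradiction (injective⇒≤ section-injective) ℕ.1+n≰n
  where
    hit : ∀ y → ∃ λ x → f x ≡ y
    hit y with any? (λ x → f x ≟ y)
    ... | yes h = h
    ... | no ¬h = contradiction (y , λ x fx≡y → ¬h (x , fx≡y)) ¬missed
    section-injective : Injective _≡_ _≡_ (proj₁ ∘ hit)
    section-injective {y} {y′} eq = trans (sym (proj₂ (hit y))) (trans (cong f eq) (proj₂ (hit y′)))

strictlyMonotone⇒injective : {f : Fin m → Fin n} → StrictlyMonotone f → Injective _≡_ _≡_ f
strictlyMonotone⇒injective f-mono {i} {j} eq with <-cmp i j
... | tri< i<j _ _ = contradiction eq (<⇒≢ (f-mono i<j))
... | tri≈ _ i≡j _ = i≡j
... | tri> _ _ j<i = contradiction (sym eq) (<⇒≢ (f-mono j<i))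

inject₁-mono-< : {i j : Fin n} → i Fin.< j → inject₁ i Fin.< inject₁ j
inject₁-mono-< {i = i} {j} = subst₂ _<_ (sym (toℕ-inject₁ i)) (sym (toℕ-inject₁ j))

strictlyMonotone⇒≥ : {f : Fin m → Fin n} → StrictlyMonotone f → ∀ i → toℕ i ≤ toℕ (f i)
strictlyMonotone⇒≥ f-mono zero = z≤n
strictlyMonotone⇒≥ f-mono (suc i) =
  ℕ.≤-<-trans (strictlyMonotone⇒≥ (f-mono ∘ inject₁-mono-<) i) (f-mono (≤̄⇒inject₁< ℕ.≤-refl))

-- The inverse is strictly monotone too, so the bound i ≤ f i also holds the other way.
strictlyMonotone⇒≗id : {f : Fin n → Fin n} → StrictlyMonotone f → f ≗ id
strictlyMonotone⇒≗id {n} {f} f-mono i =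
  toℕ-injective (ℕ.≤-antisym f[i]≤i (strictlyMonotone⇒≥ f-mono i))
  where
    f-surjective : ∀ y → ∃ λ x → f x ≡ y
    f-surjective = injective⇒surjective (strictlyMonotone⇒injective f-mono)
    g : Fin n → Fin n
    g y = proj₁ (f-surjective y)
    fg : ∀ y → f (g y) ≡ y
    fg y = proj₂ (f-surjective y)
    g-mono : StrictlyMonotone g
    g-mono {a} {b} a<b with <-cmp (g a) (g b)
    ... | tri< ga<gb _ _ = ga<gb
    ... | tri≈ _ ga≡gb _ = contradiction (trans (sym (fg a)) (trans (cong f ga≡gb) (fg b))) (<⇒≢ a<b)
    ... | tri> _ _ gb<ga = contradiction (subst₂ Fin._<_ (fg b) (fg a) (f-mono gb<ga)) (<-asym a<b)
    f[i]≤i : toℕ (f i) ≤ toℕ i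
    f[i]≤i = subst (λ j → toℕ (f i) ≤ toℕ j)
                   (strictlyMonotone⇒injective f-mono (fg (f i)))
                   (strictlyMonotone⇒≥ g-mono (f i))

order-preserving⇒≗ : {a b : Fin n → Fin n} → Injective _≡_ _≡_ a →
  (∀ {i j} → a i Fin.< a j → b i Fin.< b j) → b ≗ a
order-preserving⇒≗ {n} {a} {b} a-injective a<⇒b< i = begin
  b i           ≡⟨ cong b (sym (a-injective (a⁻¹-section (a i)))) ⟩
  b (a⁻¹ (a i)) ≡⟨ strictlyMonotone⇒≗id b∘a⁻¹-mono (a i) ⟩
  a i           ∎
  where
    open ≡-Reasoning
    a-surjective : ∀ y → ∃ λ x → a x ≡ y
    a-surjective = injective⇒surjective a-injective
    a⁻¹ : Fin n → Fin n
    a⁻¹ y = proj₁ (a-surjective y)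
    a⁻¹-section : ∀ y → a (a⁻¹ y) ≡ y
    a⁻¹-section y = proj₂ (a-surjective y)
    b∘a⁻¹-mono : StrictlyMonotone (b ∘ a⁻¹)
    b∘a⁻¹-mono {x} {y} x<y = a<⇒b< (subst₂ Fin._<_ (sym (a⁻¹-section x)) (sym (a⁻¹-section y)) x<y)

punchIn-mono-< : ∀ (i : Fin (suc n)) → StrictlyMonotone (punchIn i)
punchIn-mono-< i {j} {k} j<k =
  ≤∧≢⇒< (punchIn-mono-≤ i j k (ℕ.<⇒≤ j<k)) (<⇒≢ j<k ∘ punchIn-injective i j k)

punchIn-cancel-< : ∀ (i : Fin (suc n)) {j k : Fin n} → punchIn i j Fin.< punchIn i k → j Fin.< k
punchIn-cancel-< i {j} {k} lt =
  ≤∧≢⇒< (punchIn-cancel-≤ i j k (ℕ.<⇒≤ lt)) (<⇒≢ lt ∘ cong (punchIn i))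

punchOut-mono-< : ∀ {i j k : Fin (suc n)} (i≢j : i ≢ j) (i≢k : i ≢ k) →
  j Fin.< k → punchOut i≢j Fin.< punchOut i≢k
punchOut-mono-< i≢j i≢k j<k =
  ≤∧≢⇒< (punchOut-mono-≤ i≢j i≢k (ℕ.<⇒≤ j<k)) (<⇒≢ j<k ∘ punchOut-injective i≢j i≢k)

data PunchInView (p : Fin (suc n)) : Fin (suc n) → Set where
  at : PunchInView p p
  punched : ∀ j → PunchInView p (punchIn p j)

punchInView : ∀ (p i : Fin (suc n)) → PunchInView p i
punchInView p i with p ≟ i
... | yes refl = at
... | no p≢i = subst (PunchInView p) (punchIn-punchOut p≢i) (punched (punchOut p≢i))

punchIn-≥ : ∀ (p : Fin (suc n)) (q : Fin n) → toℕ p ≤ toℕ q → punchIn p q ≡ suc q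
punchIn-≥ zero q p≤q = refl
punchIn-≥ (suc p) (suc q) (s≤s p≤q) = cong suc (punchIn-≥ p q p≤q)

punchIn≡inject₁⊎suc : ∀ (v : Fin (suc n)) (y : Fin n) → punchIn v y ≡ inject₁ y ⊎ punchIn v y ≡ suc y
punchIn≡inject₁⊎suc zero y = inj₂ refl
punchIn≡inject₁⊎suc (suc v) zero = inj₁ refl
punchIn≡inject₁⊎suc (suc v) (suc y) with punchIn≡inject₁⊎suc v y
... | inj₁ eq = inj₁ (cong suc eq)
... | inj₂ eq = inj₂ (cong suc eq)

punchIn-inject₁-self : ∀ (x : Fin n) → punchIn (inject₁ x) x ≡ suc x
punchIn-inject₁-self zero = refl
punchIn-inject₁-self (suc x) = cong suc (punchIn-inject₁-self x)

punchIn-suc-self : ∀ (x : Fin n) → punchIn (suc x) x ≡ inject₁ x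
punchIn-suc-self zero = refl
punchIn-suc-self (suc x) = cong suc (punchIn-suc-self x)

punchIn-inject₁≡punchIn-suc : ∀ {x y : Fin n} → y ≢ x → punchIn (inject₁ x) y ≡ punchIn (suc x) y
punchIn-inject₁≡punchIn-suc {x = zero} {zero} y≢x = contradiction refl y≢x
punchIn-inject₁≡punchIn-suc {x = zero} {suc y} y≢x = refl
punchIn-inject₁≡punchIn-suc {x = suc x} {zero} y≢x = refl
punchIn-inject₁≡punchIn-suc {x = suc x} {suc y} y≢x = cong suc (punchIn-inject₁≡punchIn-suc (y≢x ∘ cong suc))

skipAdjacent : Fin (suc n) → Fin n → Fin (suc (suc n))
skipAdjacent x w = punchIn (inject₁ x) (punchIn x w)

skipAdjacent-injective : ∀ (x : Fin (suc n)) {w w′} → skipAdjacent x w ≡ skipAdjacent x w′ → w ≡ w′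
skipAdjacent-injective x = punchIn-injective x _ _ ∘ punchIn-injective (inject₁ x) _ _

skipAdjacent≢ : ∀ (x : Fin (suc n)) w {u} → u ≡ inject₁ x ⊎ u ≡ suc x → skipAdjacent x w ≢ u
skipAdjacent≢ x w (inj₁ refl) = punchInᵢ≢i (inject₁ x) (punchIn x w)
skipAdjacent≢ x w (inj₂ refl) eq =
  punchInᵢ≢i x w (punchIn-injective (inject₁ x) _ _ (trans eq (sym (punchIn-inject₁-self x))))

skipAdjacent-surjective : ∀ (x : Fin (suc n)) {v} → v ≢ inject₁ x → v ≢ suc x →
  ∃ λ w → skipAdjacent x w ≡ v
skipAdjacent-surjective x {v} v≢x v≢1+x =
  punchOut x≢y , trans (cong (punchIn (inject₁ x)) (punchIn-punchOut x≢y)) (punchIn-punchOut x≢v)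
  where
    x≢v : inject₁ x ≢ v
    x≢v = v≢x ∘ sym
    x≢y : x ≢ punchOut x≢v
    x≢y x≡y = v≢1+x (begin
      v                                  ≡⟨ punchIn-punchOut x≢v ⟨
      punchIn (inject₁ x) (punchOut x≢v) ≡⟨ cong (punchIn (inject₁ x)) x≡y ⟨
      punchIn (inject₁ x) x              ≡⟨ punchIn-inject₁-self x ⟩
      suc x                              ∎)
      where open ≡-Reasoning

length-cartesianProductWith : ∀ {A B C : Set} (f : A → B → C) (xs : List A) (ys : List B) →
  length (cartesianProductWith f xs ys) ≡ length xs * length ys
length-cartesianProductWith f [] ys = refl
length-cartesianProductWith f (x ∷ xs) ys = begin
  length (map (f x) ys ++ cartesianProductWith f xs ys)         ≡⟨ length-++ (map (f x) ys) ⟩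
  length (map (f x) ys) + length (cartesianProductWith f xs ys) ≡⟨ cong (_+ _) (length-map (f x) ys) ⟩
  length ys + length (cartesianProductWith f xs ys)             ≡⟨ cong (length ys +_) (length-cartesianProductWith f xs ys) ⟩
  length ys + length xs * length ys                             ∎
  where open ≡-Reasoning

module Extension {n : ℕ} (σ : Vec (Fin n) n) where

  extend : Fin (suc n) → Fin (suc n) → Fin (suc n) → Fin (suc n)
  extend p v i with p ≟ i
  ... | yes _ = v
  ... | no p≢i = punchIn v (lookup σ (punchOut p≢i))

  extension : Fin (suc n) → Fin (suc n) → Vec (Fin (suc n)) (suc n)
  extension p v = tabulate (extend p v)

  extend-at : ∀ p v → extend p v p ≡ v
  extend-at p v with p ≟ p
  ... | yes _ = refl
  ... | no p≢p = contradiction refl p≢p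

  extend-punchIn : ∀ p v j → extend p v (punchIn p j) ≡ punchIn v (lookup σ j)
  extend-punchIn p v j with p ≟ punchIn p j
  ... | yes p≡pj = contradiction (sym p≡pj) (punchInᵢ≢i p j)
  ... | no p≢pj = cong (punchIn v ∘ lookup σ) (trans (punchOut-cong p refl) (punchOut-punchIn p))

  extend-unique : ∀ {φ : Fin (suc n) → Fin (suc n)} p v → φ p ≡ v →
    (∀ j → φ (punchIn p j) ≡ punchIn v (lookup σ j)) → φ ≗ extend p v
  extend-unique p v φp≡v φ-punchIn i with punchInView p i
  ... | at = trans φp≡v (sym (extend-at p v))
  ... | punched j = trans (φ-punchIn j) (sym (extend-punchIn p v j))

  extend-injective : IsPerm σ → ∀ p v → Injective _≡_ _≡_ (extend p v)
  extend-injective σ-perm p v {i} {i′} eq with punchInView p i | punchInView p i′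
  ... | at | at = refl
  ... | at | punched j =
    contradiction (trans (sym (extend-punchIn p v j)) (trans (sym eq) (extend-at p v))) (punchInᵢ≢i v _)
  ... | punched j | at =
    contradiction (trans (sym (extend-punchIn p v j)) (trans eq (extend-at p v))) (punchInᵢ≢i v _)
  ... | punched j | punched j′ = cong (punchIn p) (σ-perm (punchIn-injective v _ _
    (trans (sym (extend-punchIn p v j)) (trans eq (extend-punchIn p v j′)))))

  lookup-extension : ∀ p v i → lookup (extension p v) i ≡ extend p v i
  lookup-extension p v = lookup∘tabulate (extend p v)

  extension-≡⇒≗ : ∀ p v p′ v′ → extension p v ≡ extension p′ v′ → extend p v ≗ extend p′ v′
  extension-≡⇒≗ p v p′ v′ eq i =
    trans (sym (lookup-extension p v i)) (trans (cong (λ π → lookup π i) eq) (lookup-extension p′ v′ i))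

  extension-injectiveʳ : ∀ p {v v′} → extension p v ≡ extension p v′ → v ≡ v′
  extension-injectiveʳ p {v} {v′} eq =
    trans (sym (extend-at p v)) (trans (extension-≡⇒≗ p v p v′ eq p) (extend-at p v′))

  extension-isPerm : IsPerm σ → ∀ p v → IsPerm (extension p v)
  extension-isPerm σ-perm p v {i} {j} eq = extend-injective σ-perm p v
    (trans (sym (lookup-extension p v i)) (trans eq (lookup-extension p v j)))

  extension-contains : ∀ p v → Contains σ (extension p v)
  extension-contains p v =
    punchIn p , (λ _ _ → punchIn-mono-< p) , λ i j →
      mk⇔ (subst₂ Fin._<_ (sym (entry i)) (sym (entry j)) ∘ punchIn-mono-< v)
          (punchIn-cancel-< v ∘ subst₂ Fin._<_ (entry i) (entry j))
    where
      entry : ∀ i → lookup (extension p v) (punchIn p i) ≡ punchIn v (lookup σ i)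
      entry i = trans (lookup-extension p v (punchIn p i)) (extend-punchIn p v i)

  -- An occurrence of σ in π misses one position p; as it is strictly monotone it
  -- is punchIn p, and the values it picks keep σ's order, so they are
  -- punchIn (π p) ∘ σ.
  contains⇒extension : IsPerm σ → (π : Vec (Fin (suc n)) (suc n)) → IsPerm π → Contains σ π →
    ∃₂ λ p v → π ≡ extension p v
  contains⇒extension σ-perm π π-perm (f , f-mono , f-order) =
    p , v , trans (sym (tabulate∘lookup π)) (tabulate-cong (extend-unique {φ = lookup π} p v refl π∘punchIn))
    where
      p : Fin (suc n)
      p = proj₁ (missing-value f)
      v : Fin (suc n)
      v = lookup π p
      f≢p : ∀ i → p ≢ f i
      f≢p i = proj₂ (missing-value f) i ∘ sym
      f≗punchIn : ∀ i → f i ≡ punchIn p i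
      f≗punchIn i = trans (sym (punchIn-punchOut (f≢p i)))
        (cong (punchIn p) (strictlyMonotone⇒≗id (punchOut-mono-< (f≢p _) (f≢p _) ∘ f-mono _ _) i))
      v≢ : ∀ i → v ≢ lookup π (f i)
      v≢ i = f≢p i ∘ π-perm
      τ : Fin n → Fin n
      τ i = punchOut (v≢ i)
      τ≗σ : τ ≗ lookup σ
      τ≗σ = order-preserving⇒≗ σ-perm
        (λ {i} {j} → punchOut-mono-< (v≢ i) (v≢ j) ∘ Equivalence.to (f-order i j))
      π∘punchIn : ∀ j → lookup π (punchIn p j) ≡ punchIn v (lookup σ j)
      π∘punchIn j = begin
        lookup π (punchIn p j) ≡⟨ cong (lookup π) (f≗punchIn j) ⟨
        lookup π (f j)         ≡⟨ punchIn-punchOut (v≢ j) ⟨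
        punchIn v (τ j)        ≡⟨ cong (punchIn v) (τ≗σ j) ⟩
        punchIn v (lookup σ j) ∎
        where open ≡-Reasoning

  extend-swap : IsPerm σ → ∀ q {v v′} →
    punchIn v (lookup σ q) ≡ v′ → punchIn v′ (lookup σ q) ≡ v →
    (∀ y → y ≢ lookup σ q → punchIn v y ≡ punchIn v′ y) →
    extend (suc q) v ≗ extend (inject₁ q) v′
  extend-swap σ-perm q {v} {v′} v↦v′ v′↦v v≈v′ = extend-unique (inject₁ q) v′ at-q at-others
    where
      at-q : extend (suc q) v (inject₁ q) ≡ v′
      at-q = trans (cong (extend (suc q) v) (sym (punchIn-suc-self q)))
                   (trans (extend-punchIn (suc q) v q) v↦v′)
      at-others : ∀ j → extend (suc q) v (punchIn (inject₁ q) j) ≡ punchIn v′ (lookup σ j)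
      at-others j with j ≟ q
      ... | yes refl = trans (cong (extend (suc q) v) (punchIn-inject₁-self q))
                             (trans (extend-at (suc q) v) (sym v′↦v))
      ... | no j≢q = trans (cong (extend (suc q) v) (punchIn-inject₁≡punchIn-suc j≢q))
                           (trans (extend-punchIn (suc q) v j) (v≈v′ (lookup σ j) (j≢q ∘ σ-perm)))

module Count {k : ℕ} (σ : Vec (Fin (suc k)) (suc k)) (σ-perm : IsPerm σ) where
  open Extension σ

  extensionAfter : Fin (suc k) → Fin k → Vec (Fin (suc (suc k))) (suc (suc k))
  extensionAfter q w = extension (suc q) (skipAdjacent (lookup σ q) w)

  -- Position q + 1 is the punched-in position of σ(q), so p's extension has a
  -- value adjacent to σ(q) there, which extensionAfter q w avoids.
  extension≢extensionAfter : ∀ p v q w → toℕ p ≤ toℕ q → extension p v ≢ extensionAfter q w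
  extension≢extensionAfter p v q w p≤q eq =
    skipAdjacent≢ (lookup σ q) w (punchIn≡inject₁⊎suc v (lookup σ q)) (begin
      skipAdjacent (lookup σ q) w                          ≡⟨ extend-at (suc q) _ ⟨
      extend (suc q) (skipAdjacent (lookup σ q) w) (suc q) ≡⟨ extension-≡⇒≗ p v (suc q) _ eq (suc q) ⟨
      extend p v (suc q)                                   ≡⟨ cong (extend p v) (punchIn-≥ p q p≤q) ⟨
      extend p v (punchIn p q)                             ≡⟨ extend-punchIn p v q ⟩
      punchIn v (lookup σ q)                               ∎)
    where open ≡-Reasoning

  extensionAfter-injective : ∀ {q q′ w w′} → extensionAfter q w ≡ extensionAfter q′ w′ → q ≡ q′ × w ≡ w′
  extensionAfter-injective {q} {q′} {w} {w′} eq with <-cmp q q′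
  ... | tri< q<q′ _ _ = contradiction eq (extension≢extensionAfter (suc q) _ q′ w′ q<q′)
  ... | tri> _ _ q′<q = contradiction (sym eq) (extension≢extensionAfter (suc q′) _ q w q′<q)
  ... | tri≈ _ refl _ = refl , skipAdjacent-injective (lookup σ q) (extension-injectiveʳ (suc q) eq)

  extensionsAtZero extensionsAfter canonicalExtensions : List (Vec (Fin (suc (suc k))) (suc (suc k)))
  extensionsAtZero = map (extension zero) (allFin (suc (suc k)))
  extensionsAfter = cartesianProductWith extensionAfter (allFin (suc k)) (allFin k)
  canonicalExtensions = extensionsAtZero ++ extensionsAfter

  canonicalExtensions-unique : Unique canonicalExtensions
  canonicalExtensions-unique =
    Unique.++⁺ (Unique.map⁺ (extension-injectiveʳ zero) (Unique.allFin⁺ _))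
               (Unique.cartesianProductWith⁺ extensionAfter extensionAfter-injective (Unique.allFin⁺ _) (Unique.allFin⁺ _))
               disjoint
    where
      disjoint : ∀ {π} → π ∈ extensionsAtZero × π ∈ extensionsAfter → ⊥
      disjoint (π∈₀ , π∈₊) with ∈-map⁻ (extension zero) π∈₀ | ∈-cartesianProductWith⁻ extensionAfter (allFin _) (allFin _) π∈₊
      ... | v , _ , refl | q , w , _ , _ , eq = extension≢extensionAfter zero v q w z≤n eq

  ∈canonicalExtensions⇒extension : ∀ {π} → π ∈ canonicalExtensions → ∃₂ λ p v → π ≡ extension p v
  ∈canonicalExtensions⇒extension π∈ with ∈-++⁻ extensionsAtZero π∈
  ... | inj₁ π∈₀ with ∈-map⁻ (extension zero) π∈₀
  ...   | v , _ , eq = zero , v , eq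
  ∈canonicalExtensions⇒extension π∈ | inj₂ π∈₊ with ∈-cartesianProductWith⁻ extensionAfter (allFin _) (allFin _) π∈₊
  ...   | q , w , _ , _ , eq = suc q , _ , eq

  -- Moving the new entry one step to the left through the collisions reaches
  -- position 0 or a value not adjacent to σ(q).
  extension∈canonicalExtensions : ∀ p v → extension p v ∈ canonicalExtensions
  extension∈canonicalExtensions = <-weakInduction (λ p → ∀ v → extension p v ∈ canonicalExtensions)
    (λ v → ∈-++⁺ˡ (∈-map⁺ (extension zero) (∈-allFin v))) step
    where
      step : ∀ q → (∀ v → extension (inject₁ q) v ∈ canonicalExtensions) →
        ∀ v → extension (suc q) v ∈ canonicalExtensions
      step q ih v with v ≟ inject₁ (lookup σ q) | v ≟ suc (lookup σ q)
      ... | yes refl | _ = subst (_∈ canonicalExtensions)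
        (tabulate-cong (λ i → sym (extend-swap σ-perm q (punchIn-inject₁-self _) (punchIn-suc-self _)
          (λ _ → punchIn-inject₁≡punchIn-suc) i)))
        (ih (suc (lookup σ q)))
      ... | no _ | yes refl = subst (_∈ canonicalExtensions)
        (tabulate-cong (λ i → sym (extend-swap σ-perm q (punchIn-suc-self _) (punchIn-inject₁-self _)
          (λ _ → sym ∘ punchIn-inject₁≡punchIn-suc) i)))
        (ih (inject₁ (lookup σ q)))
      ... | no v≢x | no v≢1+x with skipAdjacent-surjective (lookup σ q) v≢x v≢1+x
      ...   | w , refl = ∈-++⁺ʳ extensionsAtZero (∈-cartesianProductWith⁺ extensionAfter (∈-allFin q) (∈-allFin w))

  ∈canonicalExtensions⇔ : ∀ π → (π ∈ canonicalExtensions) ⇔ (IsPerm π × Contains σ π)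
  ∈canonicalExtensions⇔ π = mk⇔ to from
    where
      to : π ∈ canonicalExtensions → IsPerm π × Contains σ π
      to π∈ = let p , v , π≡ = ∈canonicalExtensions⇒extension π∈ in
        subst (λ π → IsPerm π × Contains σ π) (sym π≡) (extension-isPerm σ-perm p v , extension-contains p v)
      from : IsPerm π × Contains σ π → π ∈ canonicalExtensions
      from (π-perm , σ≼π) = let p , v , π≡ = contains⇒extension σ-perm π π-perm σ≼π in
        subst (_∈ canonicalExtensions) (sym π≡) (extension∈canonicalExtensions p v)

  length-canonicalExtensions : length canonicalExtensions ≡ suc (suc k) + suc k * k
  length-canonicalExtensions = begin
    length (extensionsAtZero ++ extensionsAfter)
      ≡⟨ length-++ extensionsAtZero ⟩
    length extensionsAtZero + length extensionsAfter
      ≡⟨ cong₂ _+_ (trans (length-map (extension zero) (allFin _)) (length-tabulate {n = suc (suc k)} id))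
                   (length-cartesianProductWith extensionAfter (allFin (suc k)) (allFin k)) ⟩
    suc (suc k) + length (allFin (suc k)) * length (allFin k)
      ≡⟨ cong₂ (λ a b → suc (suc k) + a * b) (length-tabulate {n = suc k} id) (length-tabulate {n = k} id) ⟩
    suc (suc k) + suc k * k
      ∎
    where open ≡-Reasoning

n²+2∸2n≡n+[n-1][n-2] : ∀ k → (2 + k) * (2 + k) + 2 ∸ 2 * (2 + k) ≡ (2 + k) + (1 + k) * k
n²+2∸2n≡n+[n-1][n-2] k = begin
  (2 + k) * (2 + k) + 2 ∸ 2 * (2 + k)                 ≡⟨ cong (_∸ 2 * (2 + k)) (expand k) ⟩
  (2 + k) + (1 + k) * k + 2 * (2 + k) ∸ 2 * (2 + k)   ≡⟨ ℕ.m+n∸n≡m _ (2 * (2 + k)) ⟩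
  (2 + k) + (1 + k) * k                               ∎
  where
    open ≡-Reasoning
    expand : ∀ k → (2 + k) * (2 + k) + 2 ≡ (2 + k) + (1 + k) * k + 2 * (2 + k)
    expand = solve-∀

corollary5p8 : (n : ℕ) → 2 ≤ n →
    (σ : Vec (Fin (n ∸ 1)) (n ∸ 1)) → IsPerm σ →
    HasCount (λ (π : Vec (Fin n) n) → IsPerm π × Contains σ π)
      (n * n + 2 ∸ 2 * n)
corollary5p8 (suc (suc k)) (s≤s (s≤s z≤n)) σ σ-perm =
  canonicalExtensions , canonicalExtensions-unique , ∈canonicalExtensions⇔ ,
  trans length-canonicalExtensions (sym (n²+2∸2n≡n+[n-1][n-2] k))
  where open Count σ σ-perm
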